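{- Let $\psi$ be a closed recHML formula and $m$ a (parallel) monitor. If $m$ is sound and complete for $\psi$ over finfinite traces, then $[\![\psi]\!]_F=\mathit{Act}^*\cup\mathit{Act}^\omega$ or $[\![\psi]\!]_F=\emptyset$.
   Context: Fix a finite set $\mathit{Act}$ of actions and $\tau\notin\mathit{Act}$. recHML formulas: $\psi::=\mathrm{tt}\mid\mathrm{ff}\mid\psi\vee\psi\mid\psi\wedge\psi\mid\langle A\rangle\psi\mid[A]\psi\mid\min X.\psi\mid\max X.\psi\mid X$ with $A\subseteq\mathit{Act}$; formulas are guarded. Finfinite traces: $\mathit{FTrc}=\mathit{Act}^*\cup\mathit{Act}^\omega$. Finfinite semantics $[\![\cdot,\sigma]\!]_F$ with valuations $\sigma$ from variables to subsets of $\mathit{FTrc}$: $[\![\mathrm{tt}]\!]_F=\mathit{FTrc}$, $[\![\mathrm{ff}]\!]_F=\emptyset$, $\vee,\wedge$ are union/intersection, $[\![\langle A\rangle\psi]\!]_F=\{ag\mid a\in A, g\in[\![\psi]\!]_F\}$, $[\![[A]\psi]\!]_F=\{g\mid\forall a\in A,\forall g'.\ g=ag'\Rightarrow g'\in[\![\psi]\!]_F\}$, $[\![\min X.\psi,\sigma]\!]_F=\bigcap\{S\mid[\![\psi,\sigma[X\mapsto S]]\!]_F\subseteq S\}$, $[\![\max X.\psi,\sigma]\!]_F=\bigcup\{S\mid S\subseteq[\![\psi,\sigma[X\mapsto S]]\!]_F\}$, $[\![X,\sigma]\!]_F=\sigma(X)$. Monitors: $m::=v\mid a.m\mid m+m\mid\mathrm{rec}\,x.m\mid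 x\mid m\otimes m\mid m\oplus m$ with verdicts $v\in\{\mathsf{end},\mathsf{no},\mathsf{yes}\}$, with a labelled transition semantics in which verdicts are irrevocable ($v\xrightarrow{a}v$ for every $a$); $m\xRightarrow{s}n$ denotes a weak transition along $s\in\mathit{Act}^*$. $m$ rejects (resp. accepts) $g\in\mathit{FTrc}$ if $m\xRightarrow{s}\mathsf{no}$ (resp. $m\xRightarrow{s}\mathsf{yes}$) for some finite prefix $s$ of $g$. $m$ is sound for $\psi$ over finfinite traces if for all $g\in\mathit{FTrc}$, rejecting $g$ implies $g\notin[\![\psi]\!]_F$ and accepting $g$ implies $g\in[\![\psi]\!]_F$; violation-complete if $g\notin[\![\psi]\!]_F$ implies $m$ rejects $g$; satisfaction-complete if $g\in[\![\psi]\!]_F$ implies $m$ accepts $g$; complete if both. -}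

module Defs where

open import Level using (Level; Lift; lift) renaming (suc to lsuc; zero to lzero)
open import Data.Nat using (ℕ; zero; suc; _≟_)
open import Data.Fin using (Fin)
open import Data.Fin.Subset using (Subset; _∈_)
open import Data.List using (List; []; _∷_)
open import Data.Product using (Σ; _×_; _,_)
open import Data.Sum using (_⊎_)
open import Data.Empty using () renaming (⊥ to ⊥₀)
open import Data.Empty.Polymorphic using (⊥)
open import Data.Unit.Polymorphic using (⊤)
open import Relation.Nullary using (¬_) renaming (yes to dyes; no to dno)
open import Relation.Binary.PropositionalEquality using (_≡_; _≢_)

data FTrc (n : ℕ) : Set where
  fin : List (Fin n) → FTrc n
  inf : (ℕ → Fin n) → FTrc n

tailω : ∀ {n} → (ℕ → Fin n) → (ℕ → Fin n)
tailω f k = f (suc k)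

Var : Set
Var = ℕ

data Form (n : ℕ) : Set where
  ftt fff : Form n
  _∨ᶠ_ _∧ᶠ_ : Form n → Form n → Form n
  ⟨_⟩ᶠ_ [_]ᶠ_ : Subset n → Form n → Form n
  minᶠ maxᶠ : Var → Form n → Form n
  varᶠ : Var → Form n

FreeIn : ∀ {n} → Var → Form n → Set
FreeIn X ftt = ⊥₀
FreeIn X fff = ⊥₀
FreeIn X (φ ∨ᶠ ψ) = FreeIn X φ ⊎ FreeIn X ψ
FreeIn X (φ ∧ᶠ ψ) = FreeIn X φ ⊎ FreeIn X ψ
FreeIn X (⟨ A ⟩ᶠ ψ) = FreeIn X ψ
FreeIn X ([ A ]ᶠ ψ) = FreeIn X ψ
FreeIn X (minᶠ Y ψ) = X ≢ Y × FreeIn X ψ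
FreeIn X (maxᶠ Y ψ) = X ≢ Y × FreeIn X ψ
FreeIn X (varᶠ Y) = X ≡ Y

ClosedF : ∀ {n} → Form n → Set
ClosedF ψ = ∀ X → ¬ FreeIn X ψ

-- every free occurrence of X in the formula lies under a modality
GuardedIn : ∀ {n} → Var → Form n → Set
GuardedIn X ftt = ⊤
GuardedIn X fff = ⊤
GuardedIn X (φ ∨ᶠ ψ) = GuardedIn X φ × GuardedIn X ψ
GuardedIn X (φ ∧ᶠ ψ) = GuardedIn X φ × GuardedIn X ψ
GuardedIn X (⟨ A ⟩ᶠ ψ) = ⊤
GuardedIn X ([ A ]ᶠ ψ) = ⊤
GuardedIn X (minᶠ Y ψ) = Y ≡ X ⊎ GuardedIn X ψ
GuardedIn X (maxᶠ Y ψ) = Y ≡ X ⊎ GuardedIn X ψ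
GuardedIn X (varᶠ Y) = X ≢ Y

Guarded : ∀ {n} → Form n → Set
Guarded ftt = ⊤
Guarded fff = ⊤
Guarded (φ ∨ᶠ ψ) = Guarded φ × Guarded ψ
Guarded (φ ∧ᶠ ψ) = Guarded φ × Guarded ψ
Guarded (⟨ A ⟩ᶠ ψ) = Guarded ψ
Guarded ([ A ]ᶠ ψ) = Guarded ψ
Guarded (minᶠ X ψ) = GuardedIn X ψ × Guarded ψ
Guarded (maxᶠ X ψ) = GuardedIn X ψ × Guarded ψ
Guarded (varᶠ X) = ⊤

Valuation : ℕ → Set₁
Valuation n = Var → FTrc n → Set

_[_↦_] : ∀ {n} → Valuation n → Var → (FTrc n → Set) → Valuation n
(σ [ X ↦ S ]) Y with X ≟ Y
... | dyes _ = S
... | dno _ = σ Y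

emptyVal : ∀ {n} → Valuation n
emptyVal _ _ = ⊥₀

⟦_,_⟧F : ∀ {n} → Form n → Valuation n → FTrc n → Set₁
⟦ ftt , σ ⟧F g = ⊤
⟦ fff , σ ⟧F g = ⊥
⟦ φ ∨ᶠ ψ , σ ⟧F g = ⟦ φ , σ ⟧F g ⊎ ⟦ ψ , σ ⟧F g
⟦ φ ∧ᶠ ψ , σ ⟧F g = ⟦ φ , σ ⟧F g × ⟦ ψ , σ ⟧F g
⟦ ⟨ A ⟩ᶠ ψ , σ ⟧F (fin []) = ⊥
⟦ ⟨ A ⟩ᶠ ψ , σ ⟧F (fin (a ∷ s)) = Lift (lsuc lzero) (a ∈ A) × ⟦ ψ , σ ⟧F (fin s)
⟦ ⟨ A ⟩ᶠ ψ , σ ⟧F (inf f) = Lift (lsuc lzero) (f 0 ∈ A) × ⟦ ψ , σ ⟧F (inf (tailω f))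
⟦ [ A ]ᶠ ψ , σ ⟧F (fin []) = ⊤
⟦ [ A ]ᶠ ψ , σ ⟧F (fin (a ∷ s)) = a ∈ A → ⟦ ψ , σ ⟧F (fin s)
⟦ [ A ]ᶠ ψ , σ ⟧F (inf f) = f 0 ∈ A → ⟦ ψ , σ ⟧F (inf (tailω f))
⟦ minᶠ X ψ , σ ⟧F g =
  (S : FTrc _ → Set) → (∀ h → ⟦ ψ , σ [ X ↦ S ] ⟧F h → S h) → Lift (lsuc lzero) (S g)
⟦ maxᶠ X ψ , σ ⟧F g =
  Σ (FTrc _ → Set) λ S → (∀ h → S h → ⟦ ψ , σ [ X ↦ S ] ⟧F h) × Lift (lsuc lzero) (S g)
⟦ varᶠ X , σ ⟧F g = Lift (lsuc lzero) (σ X g)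

data Verdict : Set where
  end no yes : Verdict

data Mon (n : ℕ) : Set where
  verd : Verdict → Mon n
  act  : Fin n → Mon n → Mon n
  _+ᵐ_ : Mon n → Mon n → Mon n
  rec  : Var → Mon n → Mon n
  mvar : Var → Mon n
  _⊗_ _⊕_ : Mon n → Mon n → Mon n

_[_≔_] : ∀ {n} → Mon n → Var → Mon n → Mon n
verd v [ x ≔ k ] = verd v
act a m [ x ≔ k ] = act a (m [ x ≔ k ])
(m +ᵐ m') [ x ≔ k ] = (m [ x ≔ k ]) +ᵐ (m' [ x ≔ k ])
rec y m [ x ≔ k ] with x ≟ y
... | dyes _ = rec y m
... | dno _ = rec y (m [ x ≔ k ])
mvar y [ x ≔ k ] with x ≟ y
... | dyes _ = k
... | dno _ = mvar y
(m ⊗ m') [ x ≔ k ] = (m [ x ≔ k ]) ⊗ (m' [ x ≔ k ])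
(m ⊕ m') [ x ≔ k ] = (m [ x ≔ k ]) ⊕ (m' [ x ≔ k ])

data Lab (n : ℕ) : Set where
  τ : Lab n
  ` : Fin n → Lab n

infix 4 _─[_]→_
data _─[_]→_ {n : ℕ} : Mon n → Lab n → Mon n → Set where
  mAct  : ∀ {a m} → act a m ─[ ` a ]→ m
  mRec  : ∀ {x m} → rec x m ─[ τ ]→ (m [ x ≔ rec x m ])
  mSelL : ∀ {m m' k μ} → m ─[ μ ]→ m' → (m +ᵐ k) ─[ μ ]→ m'
  mSelR : ∀ {m m' k μ} → k ─[ μ ]→ m' → (m +ᵐ k) ─[ μ ]→ m'
  mVrd  : ∀ {v a} → verd v ─[ ` a ]→ verd v
  mParC  : ∀ {m m' k k' a} → m ─[ ` a ]→ m' → k ─[ ` a ]→ k' → (m ⊗ k) ─[ ` a ]→ (m' ⊗ k')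
  mTauLC : ∀ {m m' k} → m ─[ τ ]→ m' → (m ⊗ k) ─[ τ ]→ (m' ⊗ k)
  mTauRC : ∀ {m k k'} → k ─[ τ ]→ k' → (m ⊗ k) ─[ τ ]→ (m ⊗ k')
  mVrEC  : (verd end ⊗ verd end) ─[ τ ]→ verd end
  mVrC1L : ∀ {m} → (verd yes ⊗ m) ─[ τ ]→ m
  mVrC1R : ∀ {m} → (m ⊗ verd yes) ─[ τ ]→ m
  mVrC2L : ∀ {m} → (verd no ⊗ m) ─[ τ ]→ verd no
  mVrC2R : ∀ {m} → (m ⊗ verd no) ─[ τ ]→ verd no
  mParD  : ∀ {m m' k k' a} → m ─[ ` a ]→ m' → k ─[ ` a ]→ k' → (m ⊕ k) ─[ ` a ]→ (m' ⊕ k')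
  mTauLD : ∀ {m m' k} → m ─[ τ ]→ m' → (m ⊕ k) ─[ τ ]→ (m' ⊕ k)
  mTauRD : ∀ {m k k'} → k ─[ τ ]→ k' → (m ⊕ k) ─[ τ ]→ (m ⊕ k')
  mVrED  : (verd end ⊕ verd end) ─[ τ ]→ verd end
  mVrD1L : ∀ {m} → (verd no ⊕ m) ─[ τ ]→ m
  mVrD1R : ∀ {m} → (m ⊕ verd no) ─[ τ ]→ m
  mVrD2L : ∀ {m} → (verd yes ⊕ m) ─[ τ ]→ verd yes
  mVrD2R : ∀ {m} → (m ⊕ verd yes) ─[ τ ]→ verd yes

infix 4 _=[_]⇒_
data _=[_]⇒_ {n : ℕ} : Mon n → List (Fin n) → Mon n → Set where
  wRefl : ∀ {m} → m =[ [] ]⇒ m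
  wTau  : ∀ {m m' k s} → m ─[ τ ]→ m' → m' =[ s ]⇒ k → m =[ s ]⇒ k
  wAct  : ∀ {m m' k a s} → m ─[ ` a ]→ m' → m' =[ s ]⇒ k → m =[ a ∷ s ]⇒ k

PrefixOf : ∀ {n} → List (Fin n) → FTrc n → Set
PrefixOf [] g = Data.Unit.Polymorphic.⊤
PrefixOf (a ∷ s) (fin []) = ⊥₀
PrefixOf (a ∷ s) (fin (b ∷ t)) = a ≡ b × PrefixOf s (fin t)
PrefixOf (a ∷ s) (inf f) = a ≡ f 0 × PrefixOf s (inf (tailω f))

Rejects Accepts : ∀ {n} → Mon n → FTrc n → Set
Rejects m g = Σ (List _) λ s → PrefixOf s g × (m =[ s ]⇒ verd no)
Accepts m g = Σ (List _) λ s → PrefixOf s g × (m =[ s ]⇒ verd yes)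

-- soundness and completeness over finfinite traces (closed formulas: empty valuation)
SoundF : ∀ {n} → Mon n → Form n → Set₁
SoundF m ψ = ∀ g → (Rejects m g → ¬ ⟦ ψ , emptyVal ⟧F g) × (Accepts m g → ⟦ ψ , emptyVal ⟧F g)

ViolationCompleteF SatisfactionCompleteF CompleteF : ∀ {n} → Mon n → Form n → Set₁
ViolationCompleteF m ψ = ∀ g → ¬ ⟦ ψ , emptyVal ⟧F g → Rejects m g
SatisfactionCompleteF m ψ = ∀ g → ⟦ ψ , emptyVal ⟧F g → Accepts m g
CompleteF m ψ = ViolationCompleteF m ψ × SatisfactionCompleteF m ψ

-- A monitor can reach a verdict on the empty trace ε only without reading any action, and a verdict
-- reached before reading anything is a verdict on every trace. Completeness forces a verdict on ε
-- (rejection if ε ∉ ⟦ψ⟧, acceptance if ε ∈ ⟦ψ⟧), and soundness turns it into the same verdict on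
-- every trace. Constructively one must decide whether ε ∈ ⟦ψ⟧: ε satisfies every [A]-formula and
-- no ⟨A⟩-formula, and guardedness keeps variables away from the top level, so this is decided by
-- structural recursion on ψ, uniformly in the valuation.
module Submission where

open import Defs
open import Data.Nat using (ℕ; _≟_)
open import Data.Fin using (Fin)
open import Data.List using (List; []; _∷_)
open import Data.Product using (_×_; _,_; proj₁; proj₂)
open import Data.Sum using (_⊎_; inj₁; inj₂)
open import Data.Empty using (⊥-elim) renaming (⊥ to ⊥₀)
import Data.Unit as Unit
open import Data.Unit.Polymorphic using (tt)
open import Level using (lift; lower)
open import Relation.Nullary using (¬_) renaming (yes to dyes; no to dno)
open import Relation.Binary.PropositionalEquality using (_≡_; refl)

private
  variable
    n : ℕ

ε : FTrc n
ε = fin []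

IsEmpty : FTrc n → Set
IsEmpty (fin []) = Unit.⊤
IsEmpty (fin (_ ∷ _)) = ⊥₀
IsEmpty (inf _) = ⊥₀

prefixOf-ε : ∀ {s : List (Fin n)} → PrefixOf s ε → s ≡ []
prefixOf-ε {s = []} _ = refl

accepts-ε⇒accepts : ∀ {m : Mon n} → Accepts m ε → ∀ g → Accepts m g
accepts-ε⇒accepts (s , s⊑ε , m⇒yes) g with prefixOf-ε s⊑ε
... | refl = [] , tt , m⇒yes

rejects-ε⇒rejects : ∀ {m : Mon n} → Rejects m ε → ∀ g → Rejects m g
rejects-ε⇒rejects (s , s⊑ε , m⇒no) g with prefixOf-ε s⊑ε
... | refl = [] , tt , m⇒no

FreeVarsGuarded : Form n → Set
FreeVarsGuarded ψ = ∀ X → FreeIn X ψ → GuardedIn X ψ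

closed⇒freeVarsGuarded : {ψ : Form n} → ClosedF ψ → FreeVarsGuarded ψ
closed⇒freeVarsGuarded closed X free = ⊥-elim (closed X free)

-- Stated for ∨ᶠ and minᶠ; FreeIn and GuardedIn unfold identically for ∧ᶠ and maxᶠ, so the
-- same lemmas apply there.
freeVarsGuarded-∨ᶠ : {φ ψ : Form n} → FreeVarsGuarded (φ ∨ᶠ ψ)
                   → FreeVarsGuarded φ × FreeVarsGuarded ψ
freeVarsGuarded-∨ᶠ fvg = (λ X free → proj₁ (fvg X (inj₁ free)))
                       , (λ X free → proj₂ (fvg X (inj₂ free)))

freeVarsGuarded-minᶠ : ∀ {X} {ψ : Form n} → GuardedIn X ψ → FreeVarsGuarded (minᶠ X ψ)
                     → FreeVarsGuarded ψ
freeVarsGuarded-minᶠ {X = X} X-guarded fvg Y free with Y ≟ X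
... | dyes refl = X-guarded
... | dno Y≢X with fvg Y (Y≢X , free)
...   | inj₁ refl = ⊥-elim (Y≢X refl)
...   | inj₂ Y-guarded = Y-guarded

EmptyTraceDecided : Form n → Set₁
EmptyTraceDecided ψ = (∀ σ → ⟦ ψ , σ ⟧F ε) ⊎ (∀ σ → ¬ ⟦ ψ , σ ⟧F ε)

emptyTraceDecided-∨ᶠ : {φ ψ : Form n} → EmptyTraceDecided φ → EmptyTraceDecided ψ
                     → EmptyTraceDecided (φ ∨ᶠ ψ)
emptyTraceDecided-∨ᶠ (inj₁ ε∈φ) _ = inj₁ λ σ → inj₁ (ε∈φ σ)
emptyTraceDecided-∨ᶠ (inj₂ _) (inj₁ ε∈ψ) = inj₁ λ σ → inj₂ (ε∈ψ σ)
emptyTraceDecided-∨ᶠ (inj₂ ε∉φ) (inj₂ ε∉ψ) = inj₂ λ σ → λ { (inj₁ p) → ε∉φ σ p ; (inj₂ q) → ε∉ψ σ q }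

emptyTraceDecided-∧ᶠ : {φ ψ : Form n} → EmptyTraceDecided φ → EmptyTraceDecided ψ
                     → EmptyTraceDecided (φ ∧ᶠ ψ)
emptyTraceDecided-∧ᶠ (inj₁ ε∈φ) (inj₁ ε∈ψ) = inj₁ λ σ → ε∈φ σ , ε∈ψ σ
emptyTraceDecided-∧ᶠ (inj₂ ε∉φ) _ = inj₂ λ σ p → ε∉φ σ (proj₁ p)
emptyTraceDecided-∧ᶠ (inj₁ _) (inj₂ ε∉ψ) = inj₂ λ σ p → ε∉ψ σ (proj₂ p)

-- If ε ∉ ⟦ψ⟧, the non-empty traces form a pre-fixed point excluding ε.
emptyTraceDecided-minᶠ : ∀ {X} {ψ : Form n} → EmptyTraceDecided ψ → EmptyTraceDecided (minᶠ X ψ)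
emptyTraceDecided-minᶠ (inj₁ ε∈ψ) = inj₁ λ σ S prefixed → lift (prefixed ε (ε∈ψ _))
emptyTraceDecided-minᶠ {X = X} {ψ} (inj₂ ε∉ψ) = inj₂ λ σ ε∈μ → lower (ε∈μ NonEmpty prefixed) Unit.tt
  where
  NonEmpty : FTrc _ → Set
  NonEmpty g = ¬ IsEmpty g

  prefixed : ∀ {σ} h → ⟦ ψ , σ [ X ↦ NonEmpty ] ⟧F h → NonEmpty h
  prefixed (fin []) h∈ψ _ = ε∉ψ _ h∈ψ
  prefixed (fin (_ ∷ _)) _ ()
  prefixed (inf _) _ ()

-- If ε ∈ ⟦ψ⟧, the singleton {ε} is a post-fixed point containing ε.
emptyTraceDecided-maxᶠ : ∀ {X} {ψ : Form n} → EmptyTraceDecided ψ → EmptyTraceDecided (maxᶠ X ψ)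
emptyTraceDecided-maxᶠ {X = X} {ψ} (inj₁ ε∈ψ) = inj₁ λ σ → IsEmpty , postfixed , lift Unit.tt
  where
  postfixed : ∀ {σ} h → IsEmpty h → ⟦ ψ , σ [ X ↦ IsEmpty ] ⟧F h
  postfixed (fin []) _ = ε∈ψ _
  postfixed (fin (_ ∷ _)) ()
  postfixed (inf _) ()
emptyTraceDecided-maxᶠ (inj₂ ε∉ψ) = inj₂ λ { σ (S , postfixed , lift ε∈S) → ε∉ψ _ (postfixed ε ε∈S) }

emptyTraceDecided : (ψ : Form n) → Guarded ψ → FreeVarsGuarded ψ → EmptyTraceDecided ψ
emptyTraceDecided ftt _ _ = inj₁ λ σ → tt
emptyTraceDecided fff _ _ = inj₂ λ σ ()
emptyTraceDecided (φ ∨ᶠ ψ) (gφ , gψ) fvg with freeVarsGuarded-∨ᶠ {φ = φ} {ψ} fvg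
... | fvgφ , fvgψ = emptyTraceDecided-∨ᶠ (emptyTraceDecided φ gφ fvgφ) (emptyTraceDecided ψ gψ fvgψ)
emptyTraceDecided (φ ∧ᶠ ψ) (gφ , gψ) fvg with freeVarsGuarded-∨ᶠ {φ = φ} {ψ} fvg
... | fvgφ , fvgψ = emptyTraceDecided-∧ᶠ (emptyTraceDecided φ gφ fvgφ) (emptyTraceDecided ψ gψ fvgψ)
emptyTraceDecided (⟨ A ⟩ᶠ ψ) _ _ = inj₂ λ σ ()
emptyTraceDecided ([ A ]ᶠ ψ) _ _ = inj₁ λ σ → tt
emptyTraceDecided (minᶠ X ψ) (X-guarded , g) fvg =
  emptyTraceDecided-minᶠ {X = X} (emptyTraceDecided ψ g (freeVarsGuarded-minᶠ X-guarded fvg))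
emptyTraceDecided (maxᶠ X ψ) (X-guarded , g) fvg =
  emptyTraceDecided-maxᶠ {X = X} (emptyTraceDecided ψ g (freeVarsGuarded-minᶠ X-guarded fvg))
emptyTraceDecided (varᶠ X) _ fvg = ⊥-elim (fvg X refl refl)

mainTheorem7 : ∀ {n : ℕ} (ψ : Form n) (m : Mon n)
    → ClosedF ψ → Guarded ψ
    → SoundF m ψ → CompleteF m ψ
    → (∀ g → ⟦ ψ , emptyVal ⟧F g) ⊎ (∀ g → ¬ ⟦ ψ , emptyVal ⟧F g)
mainTheorem7 ψ m closed guarded sound (violationComplete , satisfactionComplete)
  with emptyTraceDecided ψ guarded (closed⇒freeVarsGuarded closed)
... | inj₁ ε∈ψ = inj₁ λ g →
  proj₂ (sound g) (accepts-ε⇒accepts (satisfactionComplete ε (ε∈ψ emptyVal)) g)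
... | inj₂ ε∉ψ = inj₂ λ g →
  proj₁ (sound g) (rejects-ε⇒rejects (violationComplete ε (ε∉ψ emptyVal)) g)
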